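{- The variety $\mathcal S$ of all SMB algebras has a Taylor term.
   Context: An algebra $\mathbf A=(A;\wedge,d)$ is idempotent if $x\wedge x=x$ and $d(x,x,x)=x$ for all $x$. For a congruence ${\sim}$ of $\mathbf A$, $\mathbf A$ is an SMB algebra over ${\sim}$ if it is idempotent, $(A/{\sim};\wedge)$ is a semilattice, and on each ${\sim}$-class $\wedge$ acts as the second projection and $d$ acts as a Mal'cev operation ($d(x,y,y)=x=d(y,y,x)$); $\mathbf A$ is an SMB algebra if it is SMB over some congruence, and $\mathcal S$ is the class (variety) of all SMB algebras of arbitrary cardinality. A Taylor term for a variety $\mathcal V$ is an $n$-ary term $t$ such that $\mathcal V\models t(x,\dots,x)\approx x$ and $\mathcal V$ satisfies a finite set $\Sigma$ of identities of the form $t(u_1,\dots,u_n)\approx t(v_1,\dots,v_n)$ with all $u_i,v_j\in\{x,y\}$ such that for each $i\le n$ some identity in $\Sigma$ has $u_i=x$ and $v_i=y$. -}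

module Defs where

open import Data.Nat using (ℕ)
open import Data.Fin using (Fin)
open import Data.Bool using (Bool; true; false; if_then_else_)
open import Data.Product using (Σ; ∃; _×_; _,_)
open import Data.List using (List)
open import Data.List.Membership.Propositional using (_∈_)
open import Relation.Binary.PropositionalEquality using (_≡_)
open import Relation.Binary.Structures using (IsEquivalence)

record Algebra : Set₁ where
  field
    Carrier : Set
    _∧_     : Carrier → Carrier → Carrier
    d       : Carrier → Carrier → Carrier → Carrier

record IsIdempotent (A : Algebra) : Set where
  open Algebra A
  field
    ∧-idem : ∀ x → x ∧ x ≡ x
    d-idem : ∀ x → d x x x ≡ x

record IsCongruence (A : Algebra) (_∼_ : Algebra.Carrier A → Algebra.Carrier A → Set) : Set where
  open Algebra A
  field
    isEquivalence : IsEquivalence _∼_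
    ∧-cong : ∀ {x x′ y y′} → x ∼ x′ → y ∼ y′ → (x ∧ y) ∼ (x′ ∧ y′)
    d-cong : ∀ {x x′ y y′ z z′} → x ∼ x′ → y ∼ y′ → z ∼ z′ → d x y z ∼ d x′ y′ z′

-- A is an SMB algebra over the congruence ∼.
-- (A/∼ ; ∧) is a semilattice: the quotient operation (well defined since ∼ is a
-- congruence) is associative, commutative and idempotent, i.e. these laws hold up to ∼.
record IsSMBOver (A : Algebra) (_∼_ : Algebra.Carrier A → Algebra.Carrier A → Set) : Set where
  open Algebra A
  field
    idempotent   : IsIdempotent A
    congruence   : IsCongruence A _∼_
    quot-assoc   : ∀ x y z → ((x ∧ y) ∧ z) ∼ (x ∧ (y ∧ z))
    quot-comm    : ∀ x y → (x ∧ y) ∼ (y ∧ x)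
    quot-idem    : ∀ x → (x ∧ x) ∼ x
    ∧-proj₂      : ∀ x y → x ∼ y → x ∧ y ≡ y
    d-malcevˡ    : ∀ x y → x ∼ y → d x y y ≡ x
    d-malcevʳ    : ∀ x y → x ∼ y → d y y x ≡ x

record SMBAlgebra : Set₁ where
  field
    algebra : Algebra
    _∼_     : Algebra.Carrier algebra → Algebra.Carrier algebra → Set
    isSMB   : IsSMBOver algebra _∼_

data Term (n : ℕ) : Set where
  var  : Fin n → Term n
  meet : Term n → Term n → Term n
  dd   : Term n → Term n → Term n → Term n

⟦_⟧ : ∀ {n} → Term n → (A : Algebra) → (Fin n → Algebra.Carrier A) → Algebra.Carrier A
⟦ var i ⟧      A ρ = ρ i
⟦ meet s t ⟧   A ρ = Algebra._∧_ A (⟦ s ⟧ A ρ) (⟦ t ⟧ A ρ)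
⟦ dd s t u ⟧   A ρ = Algebra.d A (⟦ s ⟧ A ρ) (⟦ t ⟧ A ρ) (⟦ u ⟧ A ρ)

-- An identity t(u₁,…,uₙ) ≈ t(v₁,…,vₙ) with uᵢ,vᵢ ∈ {x,y}; true encodes x, false encodes y.
TwoVarIdentity : ℕ → Set
TwoVarIdentity n = (Fin n → Bool) × (Fin n → Bool)

subst2 : ∀ {n} {C : Set} → (Fin n → Bool) → C → C → Fin n → C
subst2 u x y i = if u i then x else y

SMBSatisfies : ∀ {n} → Term n → TwoVarIdentity n → Set₁
SMBSatisfies t (u , v) = ∀ (S : SMBAlgebra) → let A = SMBAlgebra.algebra S in
  ∀ (x y : Algebra.Carrier A) → ⟦ t ⟧ A (subst2 u x y) ≡ ⟦ t ⟧ A (subst2 v x y)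

IsTaylorTermSMB : ∀ {n} → Term n → Set₁
IsTaylorTermSMB {n} t =
  (∀ (S : SMBAlgebra) → let A = SMBAlgebra.algebra S in
     ∀ (x : Algebra.Carrier A) → ⟦ t ⟧ A (λ _ → x) ≡ x)
  × Σ (List (TwoVarIdentity n)) λ Σs →
      (∀ e → e ∈ Σs → SMBSatisfies t e)
    × (∀ (i : Fin n) → ∃ λ e → e ∈ Σs × (Data.Product.proj₁ e i ≡ true) × (Data.Product.proj₂ e i ≡ false))

{-# OPTIONS --safe #-}
-- The ∼-classes are Mal'cev algebras under d, and x ∧ y ∼ y ∧ x.  So in
-- t = d(x₀ ∧ x₁, x₂ ∧ x₃, x₄ ∧ x₅), feeding the pairs (x, y) and (y, x) into
-- the three places of d produces the related elements x ∧ y and y ∧ x, on which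
-- d(a, b, b) = d(b, b, a) = d(a, a, a).  These two identities and their x ↔ y
-- mirror images are identities of t that separate x from y in all six places.
module Submission where

open import Defs
open import Data.Nat using (ℕ)
open import Data.Fin using (Fin; zero; suc)
open import Data.Bool using (Bool; true; false; not; if_then_else_)
open import Data.Product using (Σ; _,_; proj₁; proj₂; ∃; _×_)
open import Data.List using (List; []; _∷_)
open import Data.List.Membership.Propositional using (_∈_)
open import Data.List.Relation.Unary.Any using (here; there)
open import Function using (_∘_)
open import Relation.Binary.PropositionalEquality using (_≡_; refl; sym; trans; cong; cong₂)

⟦⟧-cong : ∀ {n} (t : Term n) (A : Algebra) {ρ σ : Fin n → Algebra.Carrier A} →
          (∀ i → ρ i ≡ σ i) → ⟦ t ⟧ A ρ ≡ ⟦ t ⟧ A σ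
⟦⟧-cong (var i)    A ρ≗σ = ρ≗σ i
⟦⟧-cong (meet s t) A ρ≗σ = cong₂ (Algebra._∧_ A) (⟦⟧-cong s A ρ≗σ) (⟦⟧-cong t A ρ≗σ)
⟦⟧-cong (dd s t u) A ρ≗σ =
  trans (cong₂ (λ a b → Algebra.d A a b _) (⟦⟧-cong s A ρ≗σ) (⟦⟧-cong t A ρ≗σ))
        (cong (Algebra.d A _ _) (⟦⟧-cong u A ρ≗σ))

subst2-not : ∀ {n} {C : Set} (u : Fin n → Bool) (x y : C) i →
             subst2 (not ∘ u) x y i ≡ subst2 u y x i
subst2-not u x y i with u i
... | true  = refl
... | false = refl

swapIdentity : ∀ {n} → TwoVarIdentity n → TwoVarIdentity n
swapIdentity (u , v) = not ∘ u , not ∘ v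

SMBSatisfies-swap : ∀ {n} (t : Term n) (e : TwoVarIdentity n) →
                    SMBSatisfies t e → SMBSatisfies t (swapIdentity e)
SMBSatisfies-swap t (u , v) t⊨u≈v S x y = begin
  ⟦ t ⟧ A (subst2 (not ∘ u) x y) ≡⟨ ⟦⟧-cong t A (subst2-not u x y) ⟩
  ⟦ t ⟧ A (subst2 u y x)         ≡⟨ t⊨u≈v S y x ⟩
  ⟦ t ⟧ A (subst2 v y x)         ≡⟨ sym (⟦⟧-cong t A (subst2-not v x y)) ⟩
  ⟦ t ⟧ A (subst2 (not ∘ v) x y) ∎
  where
  open Relation.Binary.PropositionalEquality.≡-Reasoning
  A = SMBAlgebra.algebra S

module _ (S : SMBAlgebra) where
  open SMBAlgebra S
  open Algebra algebra
  open IsSMBOver isSMB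
  open IsIdempotent idempotent

  d-malcev-swap : ∀ {a b} → a ∼ b → d a b b ≡ d b b a
  d-malcev-swap {a} {b} a∼b = trans (d-malcevˡ a b a∼b) (sym (d-malcevʳ a b a∼b))

  d-malcev-const : ∀ {a b} → a ∼ b → d a b b ≡ d a a a
  d-malcev-const {a} {b} a∼b = trans (d-malcevˡ a b a∼b) (sym (d-idem a))

  d-∧-diagonal : ∀ x → d (x ∧ x) (x ∧ x) (x ∧ x) ≡ x
  d-∧-diagonal x = trans (cong (λ z → d z z z) (∧-idem x)) (d-idem x)

  ∧-flip : ∀ x y b →
           ((if b then x else y) ∧ (if not b then x else y)) ≡ (if b then x ∧ y else y ∧ x)
  ∧-flip x y true  = refl
  ∧-flip x y false = refl

HoldsOnClasses : TwoVarIdentity 3 → Set₁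
HoldsOnClasses (u , v) = ∀ (S : SMBAlgebra) → let open SMBAlgebra S; open Algebra algebra in
  ∀ a b → a ∼ b → d (subst2 u a b zero) (subst2 u a b (suc zero)) (subst2 u a b (suc (suc zero)))
                ≡ d (subst2 v a b zero) (subst2 v a b (suc zero)) (subst2 v a b (suc (suc zero)))

taylorTerm : Term 6
taylorTerm = dd (meet (var zero) (var (suc zero)))
                (meet (var (suc (suc zero))) (var (suc (suc (suc zero)))))
                (meet (var (suc (suc (suc (suc zero))))) (var (suc (suc (suc (suc (suc zero)))))))

-- Place i of d receives the pair (x, y) when u i = true and (y, x) otherwise.
interleave : (Fin 3 → Bool) → Fin 6 → Bool
interleave u zero                                = u zero
interleave u (suc zero)                          = not (u zero)
interleave u (suc (suc zero))                    = u (suc zero)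
interleave u (suc (suc (suc zero)))              = not (u (suc zero))
interleave u (suc (suc (suc (suc zero))))        = u (suc (suc zero))
interleave u (suc (suc (suc (suc (suc zero)))))  = not (u (suc (suc zero)))

⟦taylorTerm⟧-interleave : ∀ (S : SMBAlgebra) (u : Fin 3 → Bool) →
  let open SMBAlgebra S; open Algebra algebra in ∀ x y →
  ⟦ taylorTerm ⟧ algebra (subst2 (interleave u) x y)
    ≡ d (subst2 u (x ∧ y) (y ∧ x) zero) (subst2 u (x ∧ y) (y ∧ x) (suc zero))
        (subst2 u (x ∧ y) (y ∧ x) (suc (suc zero)))
⟦taylorTerm⟧-interleave S u x y
  rewrite ∧-flip S x y (u zero)
        | ∧-flip S x y (u (suc zero))
        | ∧-flip S x y (u (suc (suc zero))) = refl

interleaveIdentity : TwoVarIdentity 3 → TwoVarIdentity 6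
interleaveIdentity (u , v) = interleave u , interleave v

HoldsOnClasses⇒SMBSatisfies : ∀ e → HoldsOnClasses e →
                              SMBSatisfies taylorTerm (interleaveIdentity e)
HoldsOnClasses⇒SMBSatisfies (u , v) holds S x y =
  trans (⟦taylorTerm⟧-interleave S u x y)
        (trans (holds S (x ∧ y) (y ∧ x) (quot-comm x y))
               (sym (⟦taylorTerm⟧-interleave S v x y)))
  where open SMBAlgebra S; open Algebra algebra; open IsSMBOver isSMB

⟨_,_,_⟩ : Bool → Bool → Bool → Fin 3 → Bool
⟨ a , b , c ⟩ zero             = a
⟨ a , b , c ⟩ (suc zero)       = b
⟨ a , b , c ⟩ (suc (suc zero)) = c

malcevIdentity constIdentity : TwoVarIdentity 3
malcevIdentity = ⟨ true , false , false ⟩ , ⟨ false , false , true ⟩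
constIdentity  = ⟨ true , false , false ⟩ , ⟨ true , true , true ⟩

malcevIdentity-holds : HoldsOnClasses malcevIdentity
malcevIdentity-holds S a b = d-malcev-swap S

constIdentity-holds : HoldsOnClasses constIdentity
constIdentity-holds S a b = d-malcev-const S

taylorIdentities : List (TwoVarIdentity 6)
taylorIdentities = interleaveIdentity malcevIdentity
                 ∷ swapIdentity (interleaveIdentity malcevIdentity)
                 ∷ interleaveIdentity constIdentity
                 ∷ swapIdentity (interleaveIdentity constIdentity)
                 ∷ []

taylorIdentities-satisfied : ∀ e → e ∈ taylorIdentities → SMBSatisfies taylorTerm e
taylorIdentities-satisfied _ (here refl) =
  HoldsOnClasses⇒SMBSatisfies malcevIdentity malcevIdentity-holds
taylorIdentities-satisfied _ (there (here refl)) =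
  SMBSatisfies-swap taylorTerm (interleaveIdentity malcevIdentity)
    (HoldsOnClasses⇒SMBSatisfies malcevIdentity malcevIdentity-holds)
taylorIdentities-satisfied _ (there (there (here refl))) =
  HoldsOnClasses⇒SMBSatisfies constIdentity constIdentity-holds
taylorIdentities-satisfied _ (there (there (there (here refl)))) =
  SMBSatisfies-swap taylorTerm (interleaveIdentity constIdentity)
    (HoldsOnClasses⇒SMBSatisfies constIdentity constIdentity-holds)

taylorIdentities-separate : ∀ i → ∃ λ e →
  e ∈ taylorIdentities × proj₁ e i ≡ true × proj₂ e i ≡ false
taylorIdentities-separate zero                               = _ , here refl , refl , refl
taylorIdentities-separate (suc zero)                         = _ , there (here refl) , refl , refl
taylorIdentities-separate (suc (suc zero))                   = _ , there (there (there (here refl))) , refl , refl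
taylorIdentities-separate (suc (suc (suc zero)))             = _ , there (there (here refl)) , refl , refl
taylorIdentities-separate (suc (suc (suc (suc zero))))       = _ , there (here refl) , refl , refl
taylorIdentities-separate (suc (suc (suc (suc (suc zero))))) = _ , here refl , refl , refl

proposition4p5 : Σ ℕ λ n → Σ (Term n) λ t → IsTaylorTermSMB t
proposition4p5 = 6 , taylorTerm , d-∧-diagonal , taylorIdentities
               , taylorIdentities-satisfied , taylorIdentities-separate
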